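{- Let $n \ge 2$, and let $r, s$ be nonzero integers with $r > 0$ and $\gcd(r,s) = 1$. Consider the Diophantine equation $$ r\left(\sum_{i=1}^n \frac{1}{x_i}\right) = \frac{s}{x_1 x_2 \cdots x_n} $$ in nonzero integers $x_1,\dots,x_n$. Then: (1) If $r > 1$, this equation has no integer solutions. (2) If $r = 1$, this equation has infinitely many integer solutions; moreover, it has infinitely many integer solutions with $\min_i\{|x_i|\} \ge 2$. -}

module Defs where

open import Data.Nat using (ℕ)
open import Data.Integer using (ℤ; 0ℤ)
open import Data.Rational using (ℚ; 0ℚ; 1ℚ; _+_; _*_; 1/_; _/_)
open import Data.Rational.Properties using (_≟_)
import Data.Rational as ℚ
open import Data.Vec using (Vec; foldr; map; lookup)
open import Data.Fin using (Fin)
open import Data.Product using (_×_)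
open import Relation.Nullary using (yes; no)
open import Relation.Binary.PropositionalEquality using (_≡_; _≢_)

toℚ : ℤ → ℚ
toℚ z = z / 1

-- reciprocal 1/q; only ever applied to nonzero q below (the value at 0 is
-- irrelevant because all x_i are required to be nonzero)
recip : ℚ → ℚ
recip q with q ≟ 0ℚ
... | yes _ = 0ℚ
... | no q≢0 = 1/_ q {{ℚ.≢-nonZero q≢0}}

sumℚ : ∀ {n} → Vec ℚ n → ℚ
sumℚ = foldr _ _+_ 0ℚ

prodℚ : ∀ {n} → Vec ℚ n → ℚ
prodℚ = foldr _ _*_ 1ℚ

IsSolution : ∀ {n} → ℤ → ℤ → Vec ℤ n → Set
IsSolution r s x =
  (∀ i → lookup x i ≢ 0ℤ) ×
  (toℚ r * sumℚ (map (λ xi → recip (toℚ xi)) x) ≡ toℚ s * recip (prodℚ (map toℚ x)))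

-- Clearing denominators, the equation says r · e(x) = s, where e(x) = Σᵢ ∏_{j≠i} xⱼ.
-- Hence r divides s, and gcd r s = 1 forces r = 1.  For r = 1 the telescoping identity
-- 1/(m+1) − 1/m = −1/(m(m+1)) gives vectors u = (mₖ₋₁+1, …, m₀+1, −m₀), where
-- m₀ = b and mᵢ₊₁ = mᵢ(mᵢ+1), with Σ 1/uᵢ = −1/mₖ, i.e. e(u) = 1 and ∏ u = −mₖ;
-- then x = (s + mₖ) ∷ u has e(x) = s.  Since |x₁| grows with b, any finite list of
-- solutions can be avoided.
module Submission where

open import Defs
open import Data.Nat using (ℕ; zero; suc; _≥_; _≤_; _<_; s≤s; z≤n)
import Data.Nat as ℕ
import Data.Nat.Properties as ℕ
import Data.Nat.Divisibility as ℕᵈ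
open import Data.Nat.Coprimality using (1-coprimeTo)
import Data.Nat.Coprimality as Coprime
open import Data.Nat.ListAction using (sum)
open import Data.Integer using (ℤ; 0ℤ; 1ℤ; +_; _>_; ∣_∣; +<+)
import Data.Integer as ℤ
import Data.Integer.Properties as ℤ
open import Data.Integer.GCD using (gcd; gcd-greatest)
open import Data.Integer.Divisibility.Signed using (∣⇒∣ᵤ; ∣m⇒∣m*n; ∣-refl) renaming (_∣_ to _∣ₛ_)
import Data.Integer.Solver as ℤSolver
open import Data.Rational using (ℚ; mkℚ; 0ℚ; 1ℚ; _*_; ↥_)
import Data.Rational as ℚ
import Data.Rational.Properties as ℚ
import Data.Rational.Solver as ℚSolver
import Data.Fin as Fin
open import Data.Vec using (Vec; []; _∷_; lookup; map; head)
open import Data.List using (List; _∷_) renaming (map to mapᴸ)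
open import Data.List.Membership.Propositional using (_∈_; _∉_)
open import Data.List.Relation.Unary.Any using (here; there)
open import Data.Product using (_×_; _,_; ∃-syntax)
open import Data.Sum using (inj₁; inj₂)
open import Relation.Nullary using (¬_; yes; no; contradiction)
open import Relation.Binary.PropositionalEquality

toℚ-canonical : ∀ i → toℚ i ≡ mkℚ i 0 (Coprime.sym (1-coprimeTo ∣ i ∣))
toℚ-canonical i = ℚ.↥p/↧p≡p (mkℚ i 0 _)

toℚ-homo-* : ∀ i j → toℚ (i ℤ.* j) ≡ toℚ i * toℚ j
toℚ-homo-* i j rewrite toℚ-canonical i | toℚ-canonical j = refl

toℚ-homo-+ : ∀ i j → toℚ (i ℤ.+ j) ≡ toℚ i ℚ.+ toℚ j
toℚ-homo-+ i j
  rewrite toℚ-canonical i | toℚ-canonical j | ℤ.*-identityʳ i | ℤ.*-identityʳ j = refl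

toℚ-injective : ∀ {i j} → toℚ i ≡ toℚ j → i ≡ j
toℚ-injective {i} {j} eq rewrite toℚ-canonical i | toℚ-canonical j = cong ↥_ eq

toℚ-≢0 : ∀ {i} → i ≢ 0ℤ → toℚ i ≢ 0ℚ
toℚ-≢0 i≢0 eq = i≢0 (toℚ-injective eq)

recip-inverseˡ : ∀ {q} → q ≢ 0ℚ → recip q * q ≡ 1ℚ
recip-inverseˡ {q} q≢0 with q ℚ.≟ 0ℚ
... | yes q≡0 = contradiction q≡0 q≢0
... | no  q≢0 = ℚ.*-inverseˡ q {{ℚ.≢-nonZero q≢0}}

*≡⇒≡*recip : ∀ {a b p} → p ≢ 0ℚ → a * p ≡ b → a ≡ b * recip p
*≡⇒≡*recip {a} {b} {p} p≢0 a*p≡b = begin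
  a                     ≡⟨ ℚ.*-identityʳ a ⟨
  a * 1ℚ                ≡⟨ cong (a *_) (trans (ℚ.*-comm p (recip p)) (recip-inverseˡ p≢0)) ⟨
  a * (p * recip p)     ≡⟨ ℚ.*-assoc a p (recip p) ⟨
  (a * p) * recip p     ≡⟨ cong (_* recip p) a*p≡b ⟩
  b * recip p           ∎
  where open ≡-Reasoning

≡*recip⇒*≡ : ∀ {a b p} → p ≢ 0ℚ → a ≡ b * recip p → a * p ≡ b
≡*recip⇒*≡ {a} {b} {p} p≢0 a≡b/p = begin
  a * p                 ≡⟨ cong (_* p) a≡b/p ⟩
  (b * recip p) * p     ≡⟨ ℚ.*-assoc b (recip p) p ⟩
  b * (recip p * p)     ≡⟨ cong (b *_) (recip-inverseˡ p≢0) ⟩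
  b * 1ℚ                ≡⟨ ℚ.*-identityʳ b ⟩
  b                     ∎
  where open ≡-Reasoning

prodℤ : ∀ {n} → Vec ℤ n → ℤ
prodℤ []       = 1ℤ
prodℤ (a ∷ xs) = a ℤ.* prodℤ xs

-- Σᵢ ∏_{j≠i} xⱼ, the elementary symmetric polynomial of degree n − 1.
cofactorSum : ∀ {n} → Vec ℤ n → ℤ
cofactorSum []       = 0ℤ
cofactorSum (a ∷ xs) = a ℤ.* cofactorSum xs ℤ.+ prodℤ xs

NonZeroEntries : ∀ {n} → Vec ℤ n → Set
NonZeroEntries x = ∀ i → lookup x i ≢ 0ℤ

prodℚ-map-toℚ : ∀ {n} (x : Vec ℤ n) → prodℚ (map toℚ x) ≡ toℚ (prodℤ x)
prodℚ-map-toℚ []       = refl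
prodℚ-map-toℚ (a ∷ xs) = trans (cong (toℚ a *_) (prodℚ-map-toℚ xs)) (sym (toℚ-homo-* a (prodℤ xs)))

prodℤ-≢0 : ∀ {n} (x : Vec ℤ n) → NonZeroEntries x → prodℤ x ≢ 0ℤ
prodℤ-≢0 (a ∷ xs) x≢0 eq with ℤ.i*j≡0⇒i≡0∨j≡0 a eq
... | inj₁ a≡0  = x≢0 Fin.zero a≡0
... | inj₂ xs≡0 = prodℤ-≢0 xs (λ i → x≢0 (Fin.suc i)) xs≡0

prodℚ-≢0 : ∀ {n} (x : Vec ℤ n) → NonZeroEntries x → prodℚ (map toℚ x) ≢ 0ℚ
prodℚ-≢0 x x≢0 rewrite prodℚ-map-toℚ x = toℚ-≢0 (prodℤ-≢0 x x≢0)

sumRecip : ∀ {n} → Vec ℤ n → ℚ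
sumRecip x = sumℚ (map (λ xᵢ → recip (toℚ xᵢ)) x)

sumRecip*prod≡cofactorSum : ∀ {n} (x : Vec ℤ n) → NonZeroEntries x →
  sumRecip x * prodℚ (map toℚ x) ≡ toℚ (cofactorSum x)
sumRecip*prod≡cofactorSum []       _   = refl
sumRecip*prod≡cofactorSum (a ∷ xs) x≢0 = begin
  (recip (toℚ a) ℚ.+ S) * (toℚ a * P)         ≡⟨ distribute (recip (toℚ a)) (toℚ a) S P ⟩
  (recip (toℚ a) * toℚ a) * P ℚ.+ toℚ a * (S * P)
    ≡⟨ cong₂ (λ u v → u * P ℚ.+ toℚ a * v) (recip-inverseˡ (toℚ-≢0 (x≢0 Fin.zero)))
             (sumRecip*prod≡cofactorSum xs (λ i → x≢0 (Fin.suc i))) ⟩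
  1ℚ * P ℚ.+ toℚ a * toℚ (cofactorSum xs)      ≡⟨ cong₂ ℚ._+_ (trans (ℚ.*-identityˡ P) (prodℚ-map-toℚ xs))
                                                              (sym (toℚ-homo-* a (cofactorSum xs))) ⟩
  toℚ (prodℤ xs) ℚ.+ toℚ (a ℤ.* cofactorSum xs) ≡⟨ ℚ.+-comm (toℚ (prodℤ xs)) (toℚ (a ℤ.* cofactorSum xs)) ⟩
  toℚ (a ℤ.* cofactorSum xs) ℚ.+ toℚ (prodℤ xs) ≡⟨ toℚ-homo-+ (a ℤ.* cofactorSum xs) (prodℤ xs) ⟨
  toℚ (cofactorSum (a ∷ xs))                   ∎
  where
  open ≡-Reasoning
  open ℚSolver.+-*-Solver
  S P : ℚ
  S = sumRecip xs
  P = prodℚ (map toℚ xs)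
  distribute : ∀ u t S P → (u ℚ.+ S) * (t * P) ≡ (u * t) * P ℚ.+ t * (S * P)
  distribute = solve 4 (λ u t S P → (u :+ S) :* (t :* P) := (u :* t) :* P :+ t :* (S :* P)) refl

isSolution⇒cofactorEquation : ∀ {n} r s (x : Vec ℤ n) → IsSolution r s x → r ℤ.* cofactorSum x ≡ s
isSolution⇒cofactorEquation r s x (x≢0 , eq) = toℚ-injective (begin
  toℚ (r ℤ.* cofactorSum x)     ≡⟨ toℚ-homo-* r (cofactorSum x) ⟩
  toℚ r * toℚ (cofactorSum x)   ≡⟨ cong (toℚ r *_) (sumRecip*prod≡cofactorSum x x≢0) ⟨
  toℚ r * (sumRecip x * P)      ≡⟨ ℚ.*-assoc (toℚ r) (sumRecip x) P ⟨
  (toℚ r * sumRecip x) * P      ≡⟨ ≡*recip⇒*≡ (prodℚ-≢0 x x≢0) eq ⟩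
  toℚ s                         ∎)
  where
  open ≡-Reasoning
  P : ℚ
  P = prodℚ (map toℚ x)

cofactorEquation⇒isSolution : ∀ {n} r s (x : Vec ℤ n) → NonZeroEntries x →
  r ℤ.* cofactorSum x ≡ s → IsSolution r s x
cofactorEquation⇒isSolution r s x x≢0 eq = x≢0 , *≡⇒≡*recip (prodℚ-≢0 x x≢0) (begin
  (toℚ r * sumRecip x) * P      ≡⟨ ℚ.*-assoc (toℚ r) (sumRecip x) P ⟩
  toℚ r * (sumRecip x * P)      ≡⟨ cong (toℚ r *_) (sumRecip*prod≡cofactorSum x x≢0) ⟩
  toℚ r * toℚ (cofactorSum x)   ≡⟨ toℚ-homo-* r (cofactorSum x) ⟨
  toℚ (r ℤ.* cofactorSum x)     ≡⟨ cong toℚ eq ⟩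
  toℚ s                         ∎)
  where
  open ≡-Reasoning
  P : ℚ
  P = prodℚ (map toℚ x)

∣r∣≡1-if-coprime-and-r∣s : ∀ r s e → r ℤ.* e ≡ s → gcd r s ≡ 1ℤ → ∣ r ∣ ≡ 1
∣r∣≡1-if-coprime-and-r∣s r s e r*e≡s gcd≡1 =
  ℕᵈ.∣1⇒≡1 (subst (ℕᵈ._∣_ ∣ r ∣) (cong ∣_∣ gcd≡1)
    (gcd-greatest {r} {s} {r} (∣⇒∣ᵤ (∣-refl {r})) (∣⇒∣ᵤ (subst (r ∣ₛ_) r*e≡s (∣m⇒∣m*n {r} e ∣-refl)))))

pronicIterate : ℕ → ℕ → ℕ
pronicIterate zero    b = b
pronicIterate (suc k) b = suc (pronicIterate k b) ℕ.* pronicIterate k b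

pronicIterate-≥ : ∀ k b → b ≤ pronicIterate k b
pronicIterate-≥ zero    b = ℕ.≤-refl
pronicIterate-≥ (suc k) b = ℕ.≤-trans (pronicIterate-≥ k b) (ℕ.m≤m+n _ _)

telescoping : (k : ℕ) → ℕ → Vec ℤ (suc k)
telescoping zero    b = ℤ.- + b ∷ []
telescoping (suc k) b = + suc (pronicIterate k b) ∷ telescoping k b

prodℤ-telescoping : ∀ k b → prodℤ (telescoping k b) ≡ ℤ.- + pronicIterate k b
prodℤ-telescoping zero    b = ℤ.*-identityʳ (ℤ.- + b)
prodℤ-telescoping (suc k) b = begin
  + suc m ℤ.* prodℤ (telescoping k b) ≡⟨ cong (+ suc m ℤ.*_) (prodℤ-telescoping k b) ⟩
  + suc m ℤ.* ℤ.- + m                 ≡⟨ ℤ.neg-distribʳ-* (+ suc m) (+ m) ⟨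
  ℤ.- (+ suc m ℤ.* + m)               ≡⟨ cong ℤ.-_ (ℤ.pos-* (suc m) m) ⟨
  ℤ.- + pronicIterate (suc k) b       ∎
  where
  open ≡-Reasoning
  m : ℕ
  m = pronicIterate k b

cofactorSum-telescoping : ∀ k b → cofactorSum (telescoping k b) ≡ 1ℤ
cofactorSum-telescoping zero    b = cong (ℤ._+ 1ℤ) (ℤ.*-zeroʳ (ℤ.- + b))
cofactorSum-telescoping (suc k) b
  rewrite cofactorSum-telescoping k b | prodℤ-telescoping k b =
  solve 1 (λ m → (con 1ℤ :+ m) :* con 1ℤ :+ :- m := con 1ℤ) refl (+ pronicIterate k b)
  where open ℤSolver.+-*-Solver

telescoping-∣∣≥ : ∀ k {b} → 2 ≤ b → ∀ i → 2 ≤ ∣ lookup (telescoping k b) i ∣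
telescoping-∣∣≥ zero {b} b≥2 Fin.zero    = subst (2 ≤_) (sym (ℤ.∣-i∣≡∣i∣ (+ b))) b≥2
telescoping-∣∣≥ (suc k) b≥2 Fin.zero    = s≤s (ℕ.≤-trans (ℕ.≤-trans (s≤s z≤n) b≥2) (pronicIterate-≥ k _))
telescoping-∣∣≥ (suc k) b≥2 (Fin.suc i) = telescoping-∣∣≥ k b≥2 i

-- Choosing b = 2 + t + ∣s∣ makes the first entry exceed t, and all entries at least 2.
solutionFamily : ∀ k → ℤ → ℕ → Vec ℤ (suc (suc k))
solutionFamily k s t = s ℤ.+ + pronicIterate k b ∷ telescoping k b
  where
  b : ℕ
  b = 2 ℕ.+ t ℕ.+ ∣ s ∣

cofactorSum-solutionFamily : ∀ k s t → cofactorSum (solutionFamily k s t) ≡ s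
cofactorSum-solutionFamily k s t
  rewrite cofactorSum-telescoping k (2 ℕ.+ t ℕ.+ ∣ s ∣) | prodℤ-telescoping k (2 ℕ.+ t ℕ.+ ∣ s ∣) =
  solve 2 (λ s m → (s :+ m) :* con 1ℤ :+ :- m := s) refl s (+ pronicIterate k (2 ℕ.+ t ℕ.+ ∣ s ∣))
  where open ℤSolver.+-*-Solver

solutionFamily-head-∣∣≥ : ∀ k s t → 2 ℕ.+ t ≤ ∣ head (solutionFamily k s t) ∣
solutionFamily-head-∣∣≥ k s t =
  ℕ.+-cancelʳ-≤ ∣ s ∣ (2 ℕ.+ t) (∣ a ∣) (ℕ.≤-trans (pronicIterate-≥ k b) m≤∣a∣+∣s∣)
  where
  b : ℕ
  b = 2 ℕ.+ t ℕ.+ ∣ s ∣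
  a : ℤ
  a = s ℤ.+ + pronicIterate k b
  m≤∣a∣+∣s∣ : pronicIterate k b ≤ ∣ a ∣ ℕ.+ ∣ s ∣
  m≤∣a∣+∣s∣ = subst (_≤ ∣ a ∣ ℕ.+ ∣ s ∣) (cong ∣_∣ (solve 2 (λ s m → (s :+ m) :- s := m) refl s _))
                    (ℤ.∣i-j∣≤∣i∣+∣j∣ a s)
    where open ℤSolver.+-*-Solver

solutionFamily-∣∣≥ : ∀ k s t i → 2 ≤ ∣ lookup (solutionFamily k s t) i ∣
solutionFamily-∣∣≥ k s t Fin.zero    = ℕ.≤-trans (ℕ.m≤m+n 2 t) (solutionFamily-head-∣∣≥ k s t)
solutionFamily-∣∣≥ k s t (Fin.suc i) = telescoping-∣∣≥ k (ℕ.≤-trans (ℕ.m≤m+n 2 t) (ℕ.m≤m+n _ _)) i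

∣∣≥2⇒≢0 : ∀ {z} → 2 ≤ ∣ z ∣ → z ≢ 0ℤ
∣∣≥2⇒≢0 () refl

module _ {A : Set} (size : A → ℕ) where

  ∈⇒size≤sum : ∀ {x} {L : List A} → x ∈ L → size x ≤ sum (mapᴸ size L)
  ∈⇒size≤sum {L = y ∷ L} (here refl) = ℕ.m≤m+n (size y) _
  ∈⇒size≤sum {L = y ∷ L} (there x∈L) = ℕ.≤-trans (∈⇒size≤sum x∈L) (ℕ.m≤n+m _ (size y))

  unbounded-∉ : (f : ℕ → A) → (∀ t → t < size (f t)) → ∀ L → f (sum (mapᴸ size L)) ∉ L
  unbounded-∉ f large L f∈L = ℕ.<⇒≱ (large _) (∈⇒size≤sum f∈L)

theorem4p1 : (n : ℕ) → n ≥ 2 → (r s : ℤ) → r ≢ 0ℤ → s ≢ 0ℤ → r > 0ℤ → gcd r s ≡ 1ℤ →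
    ((r > 1ℤ → (x : Vec ℤ n) → ¬ IsSolution r s x)
    × (r ≡ 1ℤ →
        ((L : List (Vec ℤ n)) → ∃[ x ] (IsSolution r s x × x ∉ L))
        × ((L : List (Vec ℤ n)) → ∃[ x ] (IsSolution r s x × (∀ i → ∣ lookup x i ∣ ≥ 2) × x ∉ L))))
theorem4p1 (suc (suc k)) (s≤s (s≤s z≤n)) r s _ _ _ gcd≡1 = noSolution , λ { refl → solutions }
  where
  noSolution : r > 1ℤ → (x : Vec ℤ (suc (suc k))) → ¬ IsSolution r s x
  noSolution (+<+ 1<r) x sol =
    ℕ.<-irrefl (sym (∣r∣≡1-if-coprime-and-r∣s r s _ (isSolution⇒cofactorEquation r s x sol) gcd≡1)) 1<r

  freshSolution : (L : List (Vec ℤ (suc (suc k)))) →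
    ∃[ x ] (IsSolution 1ℤ s x × (∀ i → ∣ lookup x i ∣ ≥ 2) × x ∉ L)
  freshSolution L = x , cofactorEquation⇒isSolution 1ℤ s x (λ i → ∣∣≥2⇒≢0 (solutionFamily-∣∣≥ k s t i)) eq
                      , solutionFamily-∣∣≥ k s t
                      , unbounded-∉ size (solutionFamily k s) (λ t → ℕ.<⇒≤ (solutionFamily-head-∣∣≥ k s t)) L
    where
    size : Vec ℤ (suc (suc k)) → ℕ
    size v = ∣ head v ∣
    t : ℕ
    t = sum (mapᴸ size L)
    x : Vec ℤ (suc (suc k))
    x = solutionFamily k s t
    eq : 1ℤ ℤ.* cofactorSum x ≡ s
    eq = trans (ℤ.*-identityˡ (cofactorSum x)) (cofactorSum-solutionFamily k s t)

  solutions : ((L : List (Vec ℤ (suc (suc k)))) → ∃[ x ] (IsSolution 1ℤ s x × x ∉ L))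
            × ((L : List (Vec ℤ (suc (suc k)))) → ∃[ x ] (IsSolution 1ℤ s x × (∀ i → ∣ lookup x i ∣ ≥ 2) × x ∉ L))
  solutions = (λ L → let (x , sol , _ , x∉L) = freshSolution L in x , sol , x∉L) , freshSolution
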